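{- Let $\mathcal{L}=(L,\prec_{\mathcal{L}})$ be a computable linear order of order-type $\omega$, let $C\subseteq\mathbb{N}$ be cohesive, and let $[\varphi]$ be a non-standard element of $\Pi_C\mathcal{L}$. Then there are non-standard elements $[\psi^-]$ and $[\psi^+]$ of $\Pi_C\mathcal{L}$ with $[\psi^-]\ll_{\Pi_C\mathcal{L}}[\varphi]\ll_{\Pi_C\mathcal{L}}[\psi^+]$.
   Context: A set $C\subseteq\mathbb{N}$ is cohesive if it is infinite and for every c.e. set $W$, either $C\setminus W$ or $C\cap W$ is finite. Write $X\subseteq^* Y$ if $X\setminus Y$ is finite. For a computable linear order $\mathcal{L}=(L,\prec_{\mathcal{L}})$, the cohesive power $\Pi_C\mathcal{L}$ has as elements the classes $[\varphi]$ of partial computable $\varphi\colon\mathbb{N}\to L$ with $C\subseteq^*\mathrm{dom}(\varphi)$ under $\varphi=_C\psi$ iff $C\subseteq^*\{x:\varphi(x)\downarrow=\psi(x)\downarrow\}$, ordered by $[\varphi]\prec[\psi]$ iff $C\subseteq^*\{x:\varphi(x)\downarrow,\psi(x)\downarrow,\varphi(x)\prec_{\mathcal{L}}\psi(x)\}$. The canonical embedding maps $a\in L$ to the class of the constant function with value $a$; an element of $\Pi_C\mathcal{L}$ is standard if it is in the image of the canonical embedding, non-standard otherwise. For a linear order $\mathcal{M}$, $a\ll_{\mathcal{M}}b$ means that the open interval $\{x:a\prec x\prec b\}$ is infinite (it is taken empty if $b\preceq a$). -}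

module Defs where

open import Data.Nat using (ℕ; zero; suc; _<_)
open import Data.Fin using (Fin)
open import Data.Vec using (Vec; []; _∷_; lookup)
open import Data.List using (List)
open import Data.List.Relation.Unary.Any using (Any)
open import Data.Product using (Σ; ∃; ∃-syntax; _×_)
open import Data.Sum using (_⊎_)
open import Relation.Nullary using (¬_)
open import Relation.Binary.PropositionalEquality using (_≡_)

data PR : ℕ → Set where
  zeroF : ∀ {n} → PR n
  succF : PR 1
  proj  : ∀ {n} → Fin n → PR n
  comp  : ∀ {m n} → PR m → Vec (PR n) m → PR n
  prec  : ∀ {n} → PR n → PR (suc (suc n)) → PR (suc n)
  mu    : ∀ {n} → PR (suc n) → PR n

mutual
  data Eval : ∀ {n} → PR n → Vec ℕ n → ℕ → Set where
    ev-zero : ∀ {n} {xs : Vec ℕ n} → Eval zeroF xs 0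
    ev-succ : ∀ {x} → Eval succF (x ∷ []) (suc x)
    ev-proj : ∀ {n} {i : Fin n} {xs : Vec ℕ n} → Eval (proj i) xs (lookup xs i)
    ev-comp : ∀ {m n} {f : PR m} {gs : Vec (PR n) m} {xs : Vec ℕ n} {ys : Vec ℕ m} {y : ℕ} →
              EvalAll gs xs ys → Eval f ys y → Eval (comp f gs) xs y
    ev-prec-zero : ∀ {n} {f : PR n} {g : PR (suc (suc n))} {xs : Vec ℕ n} {y : ℕ} →
              Eval f xs y → Eval (prec f g) (0 ∷ xs) y
    ev-prec-suc : ∀ {n} {f : PR n} {g : PR (suc (suc n))} {xs : Vec ℕ n} {k y z : ℕ} →
              Eval (prec f g) (k ∷ xs) y → Eval g (k ∷ y ∷ xs) z →
              Eval (prec f g) (suc k ∷ xs) z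
    ev-mu : ∀ {n} {f : PR (suc n)} {xs : Vec ℕ n} {y : ℕ} →
              Eval f (y ∷ xs) 0 →
              (∀ z → z < y → Σ ℕ (λ v → Eval f (z ∷ xs) (suc v))) →
              Eval (mu f) xs y

  data EvalAll : ∀ {m n} → Vec (PR n) m → Vec ℕ n → Vec ℕ m → Set where
    ev-[] : ∀ {n} {xs : Vec ℕ n} → EvalAll [] xs []
    ev-∷  : ∀ {m n} {g : PR n} {gs : Vec (PR n) m} {xs : Vec ℕ n} {y : ℕ} {ys : Vec ℕ m} →
            Eval g xs y → EvalAll gs xs ys → EvalAll (g ∷ gs) xs (y ∷ ys)

_at_↓_ : PR 1 → ℕ → ℕ → Set
φ at x ↓ y = Eval φ (x ∷ []) y

-- domain of φ  (the c.e. sets are exactly such domains)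
Dom : PR 1 → ℕ → Set
Dom φ x = ∃[ y ] (φ at x ↓ y)

constF : ℕ → PR 1
constF zero    = zeroF
constF (suc a) = comp succF (constF a ∷ [])

Finite : (ℕ → Set) → Set
Finite S = ∃[ b ] (∀ x → S x → x < b)

Infinite : (ℕ → Set) → Set
Infinite S = ¬ Finite S

_⊆*_ : (ℕ → Set) → (ℕ → Set) → Set
X ⊆* Y = Finite (λ x → X x × ¬ Y x)

Cohesive : (ℕ → Set) → Set
Cohesive C = Infinite C ×
  ((W : PR 1) → Finite (λ x → C x × ¬ Dom W x) ⊎ Finite (λ x → C x × Dom W x))

-- Computable linear orders: L ⊆ ℕ given by a total computable
-- characteristic function `dom`, the order ≺ by a total computable
-- characteristic function `ord` (value 1 = true, 0 = false).

InL : PR 1 → ℕ → Set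
InL dom x = Eval dom (x ∷ []) 1

Lt : PR 2 → ℕ → ℕ → Set
Lt ord x y = Eval ord (x ∷ y ∷ []) 1

record IsCompLinOrder (dom : PR 1) (ord : PR 2) : Set where
  field
    dom-total : ∀ x → Eval dom (x ∷ []) 0 ⊎ Eval dom (x ∷ []) 1
    ord-total : ∀ x y → Eval ord (x ∷ y ∷ []) 0 ⊎ Eval ord (x ∷ y ∷ []) 1
    irrefl    : ∀ x → InL dom x → ¬ Lt ord x x
    trans     : ∀ x y z → InL dom x → InL dom y → InL dom z →
                Lt ord x y → Lt ord y z → Lt ord x z
    trichot   : ∀ x y → InL dom x → InL dom y →
                Lt ord x y ⊎ x ≡ y ⊎ Lt ord y x

-- (L, ≺) has order type ω: there is an order isomorphism (ℕ,<) ≅ (L,≺)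
-- (not required to be computable).
OrderTypeω : PR 1 → PR 2 → Set
OrderTypeω dom ord = Σ (ℕ → ℕ) λ f →
  (∀ n → InL dom (f n)) ×
  (∀ x → InL dom x → ∃[ n ] (f n ≡ x)) ×
  (∀ m n → m < n → Lt ord (f m) (f n))

Elem : PR 1 → PR 2 → (ℕ → Set) → PR 1 → Set
Elem dom ord C φ = (∀ x y → φ at x ↓ y → InL dom y) × (C ⊆* Dom φ)

EqC : (ℕ → Set) → PR 1 → PR 1 → Set
EqC C φ ψ = C ⊆* (λ x → ∃[ y ] (φ at x ↓ y × ψ at x ↓ y))

LtC : PR 2 → (ℕ → Set) → PR 1 → PR 1 → Set
LtC ord C φ ψ = C ⊆* (λ x → ∃[ y ] ∃[ z ] (φ at x ↓ y × ψ at x ↓ z × Lt ord y z))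

Standard : PR 1 → PR 2 → (ℕ → Set) → PR 1 → Set
Standard dom ord C φ = ∃[ a ] (InL dom a × EqC C φ (constF a))

-- [φ] ≪ [ψ] in Π_C L: the open interval {[χ] : [φ] ≺ [χ] ≺ [ψ]} is infinite,
-- i.e. it is not covered (up to =_C) by any finite list of elements.
FinInterval : PR 1 → PR 2 → (ℕ → Set) → PR 1 → PR 1 → Set
FinInterval dom ord C φ ψ = Σ (List (PR 1)) λ xs →
  ∀ χ → Elem dom ord C χ → LtC ord C φ χ → LtC ord C χ ψ → Any (EqC C χ) xs

_≪[_,_,_]_ : PR 1 → PR 1 → PR 2 → (ℕ → Set) → PR 1 → Set
φ ≪[ dom , ord , C ] ψ = ¬ FinInterval dom ord C φ ψ

module Submission where

open import Defs
open import Level using (0ℓ)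
open import Axiom.ExcludedMiddle using (ExcludedMiddle)
open import Data.Empty using (⊥; ⊥-elim)
open import Data.Fin using (#_)
open import Data.List using ([]; _∷_)
open import Data.List.Relation.Unary.Any using (Any; toSum)
open import Data.Nat using (ℕ; zero; suc; _+_; _<_; _≤_; z≤n; s≤s; _⊔_; _<?_)
open import Data.Nat.Properties
open import Data.Product using (Σ; ∃-syntax; _×_; _,_; proj₁; proj₂)
open import Data.Sum using (_⊎_; inj₁; inj₂; [_,_]′)
open import Data.Vec using (Vec; []; _∷_)
open import Function using (id)
open import Relation.Binary using (tri<; tri≈; tri>)
open import Relation.Binary.PropositionalEquality
open import Relation.Nullary using (¬_; yes; no)
open import Relation.Nullary.Decidable using (decidable-stable; ¬¬-excluded-middle)
open import Relation.Unary using (Pred; _∩_; _⊆_; ∁; ∅)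

-- Since [φ] is non-standard and C is cohesive, φ(x) eventually (on C) exceeds each fixed b ∈ L:
-- apply cohesiveness to the c.e. sets {x : φ(x) ≺ b} and induct along the ω-enumeration of L.
-- Let next be the computable "some larger element" map found by search, t k = next^k(min L), and
-- K(x) = μk. ¬ t(2k+2) ≺ φ(x). Then ψ⁺(x) = next^x(φ(x)) and ψ⁻(x) = t(K(x)) work: the classes
-- [next^(i+1) ∘ φ] form an infinite chain between [φ] and [ψ⁺], and the classes [next^(i+1) ∘ ψ⁻]
-- one between [ψ⁻] and [φ], because K(x) → ∞ on C and next^(i+1)(t(K)) = t(K+i+1) ≺ t(2K) ≺ φ(x).
-- Both ψ± are non-standard as they, too, eventually exceed every element of L.

mutual
  eval-deterministic : ∀ {n} {f : PR n} {xs : Vec ℕ n} {y y′} →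
                       Eval f xs y → Eval f xs y′ → y ≡ y′
  eval-deterministic ev-zero ev-zero = refl
  eval-deterministic ev-succ ev-succ = refl
  eval-deterministic ev-proj ev-proj = refl
  eval-deterministic (ev-comp es e) (ev-comp es′ e′) with evalAll-deterministic es es′
  ... | refl = eval-deterministic e e′
  eval-deterministic (ev-prec-zero e) (ev-prec-zero e′) = eval-deterministic e e′
  eval-deterministic (ev-prec-suc e g) (ev-prec-suc e′ g′) with eval-deterministic e e′
  ... | refl = eval-deterministic g g′
  eval-deterministic (ev-mu {y = y} e pos) (ev-mu {y = y′} e′ pos′) with <-cmp y y′
  ... | tri< y<y′ _ _ = ⊥-elim (0≢1+n (eval-deterministic e (proj₂ (pos′ y y<y′))))
  ... | tri≈ _ y≡y′ _ = y≡y′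
  ... | tri> _ _ y′<y = ⊥-elim (0≢1+n (eval-deterministic e′ (proj₂ (pos y′ y′<y))))

  evalAll-deterministic : ∀ {m n} {gs : Vec (PR n) m} {xs ys ys′} →
                          EvalAll gs xs ys → EvalAll gs xs ys′ → ys ≡ ys′
  evalAll-deterministic ev-[] ev-[] = refl
  evalAll-deterministic (ev-∷ e es) (ev-∷ e′ es′) =
    cong₂ _∷_ (eval-deterministic e e′) (evalAll-deterministic es es′)

module _ {X : Pred ℕ 0ℓ} where

  ⊆*-map : ∀ {Y Z : Pred ℕ 0ℓ} → Y ⊆ Z → X ⊆* Y → X ⊆* Z
  ⊆*-map Y⊆Z (b , bound) = b , λ x (Xx , ¬Zx) → bound x (Xx , λ Yx → ¬Zx (Y⊆Z Yx))

  ⊆*-zipWith : ∀ {Y Z W : Pred ℕ 0ℓ} → Y ∩ Z ⊆ W → X ⊆* Y → X ⊆* Z → X ⊆* W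
  ⊆*-zipWith {Y} {Z} {W} Y∩Z⊆W (b , bound) (b′ , bound′) = b ⊔ b′ , bound″
    where
    bound″ : ∀ x → X x × ¬ W x → x < b ⊔ b′
    bound″ x (Xx , ¬Wx) with x <? b | x <? b′
    ... | yes x<b | _       = <-≤-trans x<b (m≤m⊔n b b′)
    ... | no _    | yes x<b′ = <-≤-trans x<b′ (m≤n⊔m b b′)
    ... | no x≮b  | no x≮b′  =
      ⊥-elim (x≮b (bound x (Xx , λ Yx → x≮b′ (bound′ x (Xx , λ Zx → ¬Wx (Y∩Z⊆W (Yx , Zx)))))))

  ⊆*-all : ∀ {Y : Pred ℕ 0ℓ} → (∀ x → Y x) → X ⊆* Y
  ⊆*-all all = 0 , λ x (_ , ¬Yx) → ⊥-elim (¬Yx (all x))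

  ⊆*-≥ : ∀ b → X ⊆* (b ≤_)
  ⊆*-≥ b = b , λ x (_ , b≰x) → ≰⇒> b≰x

  finite-∩⇒⊆*∁ : ∀ {Y : Pred ℕ 0ℓ} → Finite (X ∩ Y) → X ⊆* ∁ Y
  finite-∩⇒⊆*∁ (b , bound) = b , λ x (Xx , ¬¬Yx) →
    decidable-stable (x <? b) λ x≮b → ¬¬Yx λ Yx → x≮b (bound x (Xx , Yx))

  infinite⇒¬⊆*∅ : Infinite X → ¬ X ⊆* ∅
  infinite⇒¬⊆*∅ infinite (b , bound) = infinite (b , λ x Xx → bound x (Xx , λ ()))

one : ∀ {n} → PR n
one = comp succF (zeroF ∷ [])

one-↓ : ∀ {n} {xs : Vec ℕ n} → Eval one xs 1
one-↓ = ev-comp (ev-∷ ev-zero ev-[]) ev-succ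

isZero : PR 1
isZero = prec one zeroF

isZero-0 : Eval isZero (0 ∷ []) 1
isZero-0 = ev-prec-zero one-↓

isZero-suc : ∀ k → Eval isZero (suc k ∷ []) 0
isZero-suc zero    = ev-prec-suc isZero-0 ev-zero
isZero-suc (suc k) = ev-prec-suc (isZero-suc k) ev-zero

isZero⁻¹-0 : ∀ {c} → Eval isZero (c ∷ []) 0 → ∃[ v ] c ≡ suc v
isZero⁻¹-0 {zero}  e = ⊥-elim (0≢1+n (eval-deterministic e isZero-0))
isZero⁻¹-0 {suc v} _ = v , refl

constF-↓ : ∀ a {xs : Vec ℕ 1} → Eval (constF a) xs a
constF-↓ zero    = ev-zero
constF-↓ (suc a) = ev-comp (ev-∷ (constF-↓ a) ev-[]) ev-succ

double : PR 1
double = prec zeroF (comp succF (comp succF (proj (# 1) ∷ []) ∷ []))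

double-↓ : ∀ k → double at k ↓ (k + k)
double-↓ zero    = ev-prec-zero ev-zero
double-↓ (suc k) = subst (double at suc k ↓_) (cong suc (sym (+-suc k k)))
  (ev-prec-suc (double-↓ k) (ev-comp (ev-∷ (ev-comp (ev-∷ ev-proj ev-[]) ev-succ) ev-[]) ev-succ))

mu-↓ : ∀ {n} {g : PR (suc n)} {xs : Vec ℕ n} → (∀ z → ∃[ c ] Eval g (z ∷ xs) c) →
       ∀ {w} → Eval g (w ∷ xs) 0 → ∃[ y ] Eval (mu g) xs y
mu-↓ {g = g} {xs} total {w} g-w with firstZero (suc w)
  where
  Positive : ℕ → Set
  Positive z = ∃[ v ] Eval g (z ∷ xs) (suc v)

  firstZero : ∀ m → (∀ z → z < m → Positive z) ⊎ ∃[ y ] Eval (mu g) xs y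
  firstZero zero = inj₁ λ _ ()
  firstZero (suc m) with firstZero m
  ... | inj₂ found = inj₂ found
  ... | inj₁ below with total m
  ...   | zero  , g-m = inj₂ (m , ev-mu g-m below)
  ...   | suc v , g-m = inj₁ λ z z<1+m →
                            [ below z , (λ { refl → v , g-m }) ]′ (m<1+n⇒m<n∨m≡n z<1+m)
... | inj₂ found = found
... | inj₁ below = ⊥-elim (0≢1+n (eval-deterministic g-w (proj₂ (below w (n<1+n w)))))

haltsIfPositive : PR 1 → PR 1
haltsIfPositive g = mu (comp isZero (comp g (proj (# 1) ∷ []) ∷ []))

haltsIfPositive-↓ : ∀ {g x v} → g at x ↓ suc v → Dom (haltsIfPositive g) x
haltsIfPositive-↓ {v = v} e =
  0 , ev-mu (ev-comp (ev-∷ (ev-comp (ev-∷ ev-proj ev-[]) e) ev-[]) (isZero-suc v)) λ _ ()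

haltsIfPositive⁻¹ : ∀ {g x} → Dom (haltsIfPositive g) x → ∃[ v ] g at x ↓ suc v
haltsIfPositive⁻¹ (_ , ev-mu (ev-comp (ev-∷ (ev-comp (ev-∷ ev-proj ev-[]) e) ev-[]) e-0) _)
  with isZero⁻¹-0 e-0
... | v , refl = v , e

module ComputableOmega (dom : PR 1) (ord : PR 2) (isLO : IsCompLinOrder dom ord)
                       (ω : OrderTypeω dom ord) where

  open IsCompLinOrder isLO using (dom-total; ord-total)

  L : Pred ℕ 0ℓ
  L = InL dom

  _≺_ : ℕ → ℕ → Set
  _≺_ = Lt ord

  ≺-irrefl : ∀ {x} → L x → ¬ x ≺ x
  ≺-irrefl = IsCompLinOrder.irrefl isLO _

  ≺-trans : ∀ {x y z} → L x → L y → L z → x ≺ y → y ≺ z → x ≺ z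
  ≺-trans = IsCompLinOrder.trans isLO _ _ _

  ≺-trichotomous : ∀ {x y} → L x → L y → x ≺ y ⊎ x ≡ y ⊎ y ≺ x
  ≺-trichotomous = IsCompLinOrder.trichot isLO _ _

  ≺-asym : ∀ {x y} → L x → L y → x ≺ y → ¬ y ≺ x
  ≺-asym x∈L y∈L x≺y y≺x = ≺-irrefl x∈L (≺-trans x∈L y∈L x∈L x≺y y≺x)

  ord-positive : ∀ {x y v} → Eval ord (x ∷ y ∷ []) (suc v) → x ≺ y
  ord-positive {x} {y} e with ord-total x y
  ... | inj₁ e-0 = ⊥-elim (0≢1+n (eval-deterministic e-0 e))
  ... | inj₂ x≺y = x≺y

  ⊀⇒ord-0 : ∀ {x y} → ¬ x ≺ y → Eval ord (x ∷ y ∷ []) 0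
  ⊀⇒ord-0 {x} {y} x⊀y with ord-total x y
  ... | inj₁ e-0 = e-0
  ... | inj₂ x≺y = ⊥-elim (x⊀y x≺y)

  ord-value : ∀ x y → ∃[ c ] Eval ord (x ∷ y ∷ []) c
  ord-value x y = [ (0 ,_) , (1 ,_) ]′ (ord-total x y)

  enum : ℕ → ℕ
  enum = proj₁ ω

  enum-L : ∀ n → L (enum n)
  enum-L = proj₁ (proj₂ ω)

  enum-onto : ∀ {x} → L x → ∃[ n ] enum n ≡ x
  enum-onto = proj₁ (proj₂ (proj₂ ω)) _

  enum-mono : ∀ {m n} → m < n → enum m ≺ enum n
  enum-mono = proj₂ (proj₂ (proj₂ ω)) _ _

  enum-reflects-≺ : ∀ {m n} → enum m ≺ enum n → m < n
  enum-reflects-≺ {m} {n} e≺e with <-cmp m n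
  ... | tri< m<n _ _ = m<n
  ... | tri≈ _ refl _ = ⊥-elim (≺-irrefl (enum-L m) e≺e)
  ... | tri> _ _ n<m = ⊥-elim (≺-asym (enum-L m) (enum-L n) e≺e (enum-mono n<m))

  enum-0-minimal : ∀ {y} → L y → ¬ y ≺ enum 0
  enum-0-minimal y∈L y≺e₀ with enum-onto y∈L
  ... | m , refl with enum-reflects-≺ y≺e₀
  ... | ()

  ≺enum-suc⇒≡enum : ∀ {n y} → L y → y ≺ enum (suc n) → ¬ y ≺ enum n → y ≡ enum n
  ≺enum-suc⇒≡enum y∈L y≺ y⊀ with enum-onto y∈L
  ... | m , refl with m<1+n⇒m<n∨m≡n (enum-reflects-≺ y≺)
  ...   | inj₁ m<n  = ⊥-elim (y⊀ (enum-mono m<n))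
  ...   | inj₂ refl = refl

  nand : PR 2
  nand = prec one (comp isZero (proj (# 2) ∷ []))

  nand-0 : ∀ {c} → Eval nand (0 ∷ c ∷ []) 1
  nand-0 = ev-prec-zero one-↓

  nand-1 : ∀ {c r} → Eval isZero (c ∷ []) r → Eval nand (1 ∷ c ∷ []) r
  nand-1 e = ev-prec-suc nand-0 (ev-comp (ev-∷ ev-proj ev-[]) e)

  -- (z , y) ↦ 0 exactly when z ∈ L and y ≺ z
  aboveTest : PR 2
  aboveTest = comp nand (comp dom (proj (# 0) ∷ []) ∷ comp ord (proj (# 1) ∷ proj (# 0) ∷ []) ∷ [])

  aboveTest-↓ : ∀ {z y a c r} → Eval dom (z ∷ []) a → Eval ord (y ∷ z ∷ []) c →
                Eval nand (a ∷ c ∷ []) r → Eval aboveTest (z ∷ y ∷ []) r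
  aboveTest-↓ e-dom e-ord e-nand = ev-comp
    (ev-∷ (ev-comp (ev-∷ ev-proj ev-[]) e-dom)
      (ev-∷ (ev-comp (ev-∷ ev-proj (ev-∷ ev-proj ev-[])) e-ord) ev-[]))
    e-nand

  aboveTest-cases : ∀ z y → (L z × y ≺ z × Eval aboveTest (z ∷ y ∷ []) 0)
                          ⊎ Eval aboveTest (z ∷ y ∷ []) 1
  aboveTest-cases z y with dom-total z | ord-total y z
  ... | inj₁ z∉L | inj₁ e   = inj₂ (aboveTest-↓ z∉L e nand-0)
  ... | inj₁ z∉L | inj₂ e   = inj₂ (aboveTest-↓ z∉L e nand-0)
  ... | inj₂ z∈L | inj₁ y⊀z = inj₂ (aboveTest-↓ z∈L y⊀z (nand-1 isZero-0))
  ... | inj₂ z∈L | inj₂ y≺z = inj₁ (z∈L , y≺z , aboveTest-↓ z∈L y≺z (nand-1 (isZero-suc 0)))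

  next : PR 1
  next = mu aboveTest

  next-sound : ∀ {y z} → next at y ↓ z → L z × y ≺ z
  next-sound {y} {z} (ev-mu e _) with aboveTest-cases z y
  ... | inj₁ (z∈L , y≺z , _) = z∈L , y≺z
  ... | inj₂ e-1 = ⊥-elim (0≢1+n (eval-deterministic e e-1))

  next-total : ∀ {y} → L y → ∃[ z ] next at y ↓ z
  next-total y∈L with enum-onto y∈L
  ... | n , refl =
    mu-↓ total (aboveTest-↓ (enum-L (suc n)) (enum-mono (n<1+n n)) (nand-1 (isZero-suc 0)))
    where
    total : ∀ z → ∃[ c ] Eval aboveTest (z ∷ enum n ∷ []) c
    total z = [ (λ (_ , _ , e) → 0 , e) , (1 ,_) ]′ (aboveTest-cases z (enum n))

  Elt : Set
  Elt = Σ ℕ L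

  nextElt : Elt → Elt
  nextElt (y , y∈L) = proj₁ (next-total y∈L) , proj₁ (next-sound (proj₂ (next-total y∈L)))

  next-↓ : ∀ p → next at proj₁ p ↓ proj₁ (nextElt p)
  next-↓ (y , y∈L) = proj₂ (next-total y∈L)

  ≺nextElt : ∀ p → proj₁ p ≺ proj₁ (nextElt p)
  ≺nextElt (y , y∈L) = proj₂ (next-sound (proj₂ (next-total y∈L)))

  next^ : ℕ → Elt → Elt
  next^ zero    p = p
  next^ (suc n) p = nextElt (next^ n p)

  next^-+ : ∀ m n p → next^ m (next^ n p) ≡ next^ (m + n) p
  next^-+ zero    n p = refl
  next^-+ (suc m) n p = cong nextElt (next^-+ m n p)

  next^-strictMono : ∀ p {m n} → m < n → proj₁ (next^ m p) ≺ proj₁ (next^ n p)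
  next^-strictMono p {m} {suc n} m<1+n with m<1+n⇒m<n∨m≡n m<1+n
  ... | inj₂ refl = ≺nextElt (next^ m p)
  ... | inj₁ m<n  = ≺-trans (proj₂ (next^ m p)) (proj₂ (next^ n p)) (proj₂ (next^ (suc n) p))
                            (next^-strictMono p m<n) (≺nextElt (next^ n p))

  ≺-next^ : ∀ {a} p n → L a → a ≺ proj₁ p → a ≺ proj₁ (next^ n p)
  ≺-next^ p zero    a∈L a≺p = a≺p
  ≺-next^ p (suc n) a∈L a≺p = ≺-trans a∈L (proj₂ (next^ n p)) (proj₂ (next^ (suc n) p))
                                      (≺-next^ p n a∈L a≺p) (≺nextElt (next^ n p))

  next^-≺-antitone : ∀ p {m n y} → L y → m ≤ n → proj₁ (next^ n p) ≺ y → proj₁ (next^ m p) ≺ y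
  next^-≺-antitone p {m} {n} y∈L m≤n ≺y with m≤n⇒m<n∨m≡n m≤n
  ... | inj₂ refl = ≺y
  ... | inj₁ m<n  = ≺-trans (proj₂ (next^ m p)) (proj₂ (next^ n p)) y∈L (next^-strictMono p m<n) ≺y

  next^-index : ∀ p n {m} → enum m ≡ proj₁ (next^ n p) → n ≤ m
  next^-index p zero    _  = z≤n
  next^-index p (suc n) eq =
    let m′ , eq′ = enum-onto (proj₂ (next^ n p))
    in ≤-<-trans (next^-index p n eq′)
                 (enum-reflects-≺ (subst₂ _≺_ (sym eq′) (sym eq) (≺nextElt (next^ n p))))

  next^-unbounded : ∀ p {b} → L b → ∃[ N ] b ≺ proj₁ (next^ N p)
  next^-unbounded p b∈L with enum-onto b∈L
  ... | j , refl =
    let m , eq = enum-onto (proj₂ (next^ (suc j) p))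
    in suc j , subst (enum j ≺_) eq (enum-mono (next^-index p (suc j) eq))

  iterate : ∀ {n} → PR n → PR (suc n)
  iterate g = prec g (comp next (proj (# 1) ∷ []))

  iterate-↓ : ∀ {n} {g : PR n} {xs} p → Eval g xs (proj₁ p) →
              ∀ k → Eval (iterate g) (k ∷ xs) (proj₁ (next^ k p))
  iterate-↓ p e zero    = ev-prec-zero e
  iterate-↓ p e (suc k) =
    ev-prec-suc (iterate-↓ p e k) (ev-comp (ev-∷ ev-proj ev-[]) (next-↓ (next^ k p)))

  iterate-base : ∀ {n} {g : PR n} {xs k z} → Eval (iterate g) (k ∷ xs) z → ∃[ y ] Eval g xs y
  iterate-base (ev-prec-zero e)  = _ , e
  iterate-base (ev-prec-suc e _) = iterate-base e

  infix 25 next^[_]_ next^⟨_⟩_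

  -- x ↦ next^(h x) (g x)
  next^[_]_ : PR 1 → PR 1 → PR 1
  next^[ h ] g = comp (iterate g) (h ∷ proj (# 0) ∷ [])

  next^⟨_⟩_ : ℕ → PR 1 → PR 1
  next^⟨ i ⟩ g = next^[ constF i ] g

  next^[]-↓ : ∀ {h g x k} → h at x ↓ k → ∀ p → g at x ↓ proj₁ p →
              next^[ h ] g at x ↓ proj₁ (next^ k p)
  next^[]-↓ h-↓ p g-↓ = ev-comp (ev-∷ h-↓ (ev-∷ ev-proj ev-[])) (iterate-↓ p g-↓ _)

  next^[]⁻¹ : ∀ {h g x z} → (∀ {y} → g at x ↓ y → L y) → next^[ h ] g at x ↓ z →
              ∃[ k ] Σ Elt λ p → h at x ↓ k × g at x ↓ proj₁ p × z ≡ proj₁ (next^ k p)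
  next^[]⁻¹ g-L (ev-comp (ev-∷ h-↓ (ev-∷ ev-proj ev-[])) e) =
    let y , g-↓ = iterate-base e
        p = y , g-L g-↓
    in _ , p , h-↓ , g-↓ , eval-deterministic e (iterate-↓ p g-↓ _)

  compareAt : PR 1 → PR 1 → PR 2
  compareAt s φ = comp ord (comp s (proj (# 0) ∷ []) ∷ comp φ (proj (# 1) ∷ []) ∷ [])

  -- x ↦ μk. ¬ s(k) ≺ φ(x)
  firstNotBelow : PR 1 → PR 1 → PR 1
  firstNotBelow s φ = mu (compareAt s φ)

  module _ {s : PR 1} {sv : ℕ → ℕ} (s-↓ : ∀ k → s at k ↓ sv k)
           {φ : PR 1} {x y : ℕ} (φ-↓ : φ at x ↓ y) where

    private
      compareAt-↓ : ∀ {k c} → Eval ord (sv k ∷ y ∷ []) c → Eval (compareAt s φ) (k ∷ x ∷ []) c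
      compareAt-↓ {k} = ev-comp (ev-∷ (ev-comp (ev-∷ ev-proj ev-[]) (s-↓ k))
                             (ev-∷ (ev-comp (ev-∷ ev-proj ev-[]) φ-↓) ev-[]))

    firstNotBelow-↓ : ∀ {k} → ¬ sv k ≺ y → ∃[ K ] firstNotBelow s φ at x ↓ K
    firstNotBelow-↓ sk⊀y =
      mu-↓ (λ z → let c , e = ord-value (sv z) y in c , compareAt-↓ e) (compareAt-↓ (⊀⇒ord-0 sk⊀y))

    firstNotBelow-below : ∀ {K z} → firstNotBelow s φ at x ↓ K → z < K → sv z ≺ y
    firstNotBelow-below {z = z} (ev-mu _ positive) z<K with ord-total (sv z) y
    ... | inj₁ e-0  = ⊥-elim (0≢1+n (eval-deterministic (compareAt-↓ e-0) (proj₂ (positive z z<K))))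
    ... | inj₂ sz≺y = sz≺y

    firstNotBelow-stop : ∀ {K} → firstNotBelow s φ at x ↓ K → ¬ sv K ≺ y
    firstNotBelow-stop (ev-mu e-0 _) sK≺y = 0≢1+n (eval-deterministic e-0 (compareAt-↓ sK≺y))

  -- the c.e. set {x : φ(x) ≺ b}
  below : PR 1 → ℕ → PR 1
  below φ b = haltsIfPositive (comp ord (φ ∷ constF b ∷ []))

  below-↓ : ∀ {φ b x y} → φ at x ↓ y → y ≺ b → Dom (below φ b) x
  below-↓ {b = b} φ-↓ y≺b = haltsIfPositive-↓ (ev-comp (ev-∷ φ-↓ (ev-∷ (constF-↓ b) ev-[])) y≺b)

  below⁻¹ : ∀ {φ b x} → Dom (below φ b) x → ∃[ y ] φ at x ↓ y × y ≺ b
  below⁻¹ {b = b} x∈below with haltsIfPositive⁻¹ x∈below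
  ... | _ , ev-comp (ev-∷ φ-↓ (ev-∷ b-↓ ev-[])) e with eval-deterministic b-↓ (constF-↓ b)
  ...   | refl = _ , φ-↓ , ord-positive e

  module CohesivePower (C : Pred ℕ 0ℓ) (cohesive : Cohesive C) where

    Element : PR 1 → Set
    Element = Elem dom ord C

    _≈ᶜ_ _≺ᶜ_ _≪ᶜ_ : PR 1 → PR 1 → Set
    _≈ᶜ_ = EqC C
    _≺ᶜ_ = LtC ord C
    φ ≪ᶜ ψ = φ ≪[ dom , ord , C ] ψ

    ≈ᶜ-sym : ∀ {g h} → g ≈ᶜ h → h ≈ᶜ g
    ≈ᶜ-sym = ⊆*-map λ (y , g-↓ , h-↓) → y , h-↓ , g-↓

    ≈ᶜ-trans : ∀ {g h k} → g ≈ᶜ h → h ≈ᶜ k → g ≈ᶜ k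
    ≈ᶜ-trans {k = k} = ⊆*-zipWith λ {x} ((y , g-↓ , h-↓) , (_ , h-↓′ , k-↓)) →
      y , g-↓ , subst (k at x ↓_) (sym (eval-deterministic h-↓ h-↓′)) k-↓

    ≺ᶜ⇒≉ᶜ : ∀ {g h} → Element g → g ≺ᶜ h → ¬ g ≈ᶜ h
    ≺ᶜ⇒≉ᶜ (g-L , _) g≺h g≈h = infinite⇒¬⊆*∅ (proj₁ cohesive) (⊆*-zipWith
      (λ ((y , z , g-↓ , h-↓ , y≺z) , (_ , g-↓′ , h-↓′)) →
        ≺-irrefl (g-L _ _ g-↓)
          (subst (y ≺_) (trans (eval-deterministic h-↓ h-↓′) (sym (eval-deterministic g-↓ g-↓′))) y≺z))
      g≺h g≈h)

    Element-constF : ∀ {a} → L a → Element (constF a)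
    Element-constF {a} a∈L =
      (λ _ _ e → subst L (sym (eval-deterministic e (constF-↓ a))) a∈L) , ⊆*-all λ _ → a , constF-↓ a

    next^[]-Element : ∀ {h g} → Element g → C ⊆* Dom h → Element (next^[ h ] g)
    next^[]-Element (g-L , g-dom) h-dom =
      (λ _ _ e → let k , p , _ , _ , eq = next^[]⁻¹ (g-L _ _) e
                 in subst L (sym eq) (proj₂ (next^ k p))) ,
      ⊆*-zipWith (λ ((y , g-↓) , (_ , h-↓)) → _ , next^[]-↓ h-↓ (y , g-L _ _ g-↓) g-↓) g-dom h-dom

    next^[]-≺ᶜ : ∀ {h h′ g} → Element g →
                 C ⊆* (λ x → ∃[ k ] ∃[ k′ ] h at x ↓ k × h′ at x ↓ k′ × k < k′) →
                 next^[ h ] g ≺ᶜ next^[ h′ ] g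
    next^[]-≺ᶜ (g-L , g-dom) = ⊆*-zipWith
      (λ ((y , g-↓) , (_ , _ , h-↓ , h′-↓ , k<k′)) → let p = y , g-L _ _ g-↓ in
        _ , _ , next^[]-↓ h-↓ p g-↓ , next^[]-↓ h′-↓ p g-↓ , next^-strictMono p k<k′)
      g-dom

    ≺ᶜnext^⟨suc⟩ : ∀ {g} i → Element g → g ≺ᶜ next^⟨ suc i ⟩ g
    ≺ᶜnext^⟨suc⟩ i (g-L , g-dom) = ⊆*-map
      (λ (y , g-↓) → let p = y , g-L _ _ g-↓ in
        y , _ , g-↓ , next^[]-↓ (constF-↓ (suc i)) p g-↓ ,
        next^-strictMono p {0} {suc i} (s≤s z≤n))
      g-dom

    -- Each y of a finite list is =_C to at most one χ j, so some χ j escapes the list; as ≪ is a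
    -- negation, the case split on whether y is hit at all can be made under ¬¬.
    ≪ᶜ-from-chain : ∀ {lo hi} (χ : ℕ → PR 1) → (∀ i → Element (χ i)) →
                    (∀ {i j} → i < j → χ i ≺ᶜ χ j) →
                    (∀ i → lo ≺ᶜ χ i) → (∀ i → χ i ≺ᶜ hi) → lo ≪ᶜ hi
    ≪ᶜ-from-chain χ χ-elem χ-chain lo≺χ χ≺hi (ys , covered) =
      escapes ys 0 λ {j} _ → covered (χ j) (χ-elem j) (lo≺χ j) (χ≺hi j)
      where
      escapes : ∀ ys m → ¬ (∀ {j} → m ≤ j → Any (χ j ≈ᶜ_) ys)
      escapes []       m covers with covers ≤-refl
      ... | ()
      escapes (y ∷ ys) m covers = ¬¬-excluded-middle {A = ∃[ j ] m ≤ j × χ j ≈ᶜ y} λ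
        { (yes (j , m≤j , χj≈y)) → escapes ys (suc j) λ {k} j<k →
            [ (λ χk≈y → ⊥-elim (≺ᶜ⇒≉ᶜ (χ-elem j) (χ-chain j<k) (≈ᶜ-trans χj≈y (≈ᶜ-sym χk≈y))))
            , id ]′ (toSum (covers (≤-trans m≤j (<⇒≤ j<k))))
        ; (no ∄j) → escapes ys m λ {k} m≤k →
            [ (λ χk≈y → ⊥-elim (∄j (k , m≤k , χk≈y))) , id ]′ (toSum (covers m≤k)) }

    ≪ᶜ-from-next^ : ∀ {g hi} → Element g → (∀ i → next^⟨ suc i ⟩ g ≺ᶜ hi) → g ≪ᶜ hi
    ≪ᶜ-from-next^ {g} g-elem next^≺hi = ≪ᶜ-from-chain (λ i → next^⟨ suc i ⟩ g)
      (λ i → next^[]-Element g-elem (⊆*-all λ _ → suc i , constF-↓ (suc i)))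
      (λ {i} {j} i<j → next^[]-≺ᶜ g-elem (⊆*-all λ _ →
        suc i , suc j , constF-↓ (suc i) , constF-↓ (suc j) , s≤s i<j))
      (λ i → ≺ᶜnext^⟨suc⟩ i g-elem)
      next^≺hi

    EventuallyAbove : PR 1 → ℕ → Set
    EventuallyAbove ψ a = C ⊆* (λ x → ∃[ v ] ψ at x ↓ v × a ≺ v)

    eventuallyAbove⇒nonstandard : ∀ {ψ} → (∀ {a} → L a → EventuallyAbove ψ a) →
                                  ¬ Standard dom ord C ψ
    eventuallyAbove⇒nonstandard above (a , a∈L , ψ≈a) = infinite⇒¬⊆*∅ (proj₁ cohesive) (⊆*-zipWith
      (λ ((v , ψ-↓ , a≺v) , (_ , ψ-↓′ , a-↓)) →
        let v≡a = trans (eval-deterministic ψ-↓ ψ-↓′) (eval-deterministic a-↓ (constF-↓ a))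
        in ≺-irrefl a∈L (subst (a ≺_) v≡a a≺v))
      (above a∈L) ψ≈a)

    nonstandard⇒eventuallyAbove : ∀ {φ} → Element φ → ¬ Standard dom ord C φ →
                                  ∀ {a} → L a → EventuallyAbove φ a
    nonstandard⇒eventuallyAbove {φ} (φ-L , φ-dom) φ-nonstd a∈L with enum-onto a∈L
    ... | n , refl = ⊆*-map above (notBelow (suc n))
      where
      pinned : ∀ {m x} → ∃[ y ] φ at x ↓ y × ¬ y ≺ enum m → Dom (below φ (enum (suc m))) x →
               ∃[ y ] φ at x ↓ y × constF (enum m) at x ↓ y
      pinned {m} {x} (y , φ-↓ , y⊀) x∈below =
        let y′ , φ-↓′ , y′≺ = below⁻¹ x∈below
            y≺ = subst (_≺ enum (suc m)) (eval-deterministic φ-↓′ φ-↓) y′≺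
        in enum m , subst (φ at x ↓_) (≺enum-suc⇒≡enum (φ-L _ _ φ-↓) y≺ y⊀) φ-↓ , constF-↓ (enum m)

      notBelow : ∀ m → C ⊆* (λ x → ∃[ y ] φ at x ↓ y × ¬ y ≺ enum m)
      notBelow zero = ⊆*-map (λ (y , φ-↓) → y , φ-↓ , enum-0-minimal (φ-L _ _ φ-↓)) φ-dom
      -- Cohesiveness for {x : φ x ≺ enum (m+1)}: if C is almost inside it, [φ] is the standard enum m.
      notBelow (suc m) with proj₂ cohesive (below φ (enum (suc m)))
      ... | inj₁ C⊆*below = ⊥-elim (φ-nonstd (enum m , enum-L m ,
              ⊆*-zipWith (λ (φx⊀ , x∈below) → pinned φx⊀ x∈below) (notBelow m) C⊆*below))
      ... | inj₂ finite = ⊆*-zipWith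
              (λ ((y , φ-↓) , x∉below) → y , φ-↓ , λ y≺ → x∉below (below-↓ φ-↓ y≺))
              φ-dom (finite-∩⇒⊆*∁ finite)

      above : ∀ {x} → ∃[ y ] φ at x ↓ y × ¬ y ≺ enum (suc n) → ∃[ v ] φ at x ↓ v × enum n ≺ v
      above (y , φ-↓ , y⊀) with ≺-trichotomous (φ-L _ _ φ-↓) (enum-L (suc n))
      ... | inj₁ y≺ = ⊥-elim (y⊀ y≺)
      ... | inj₂ (inj₁ refl) = y , φ-↓ , enum-mono (n<1+n n)
      ... | inj₂ (inj₂ ≺y) =
        y , φ-↓ , ≺-trans (enum-L n) (enum-L (suc n)) (φ-L _ _ φ-↓) (enum-mono (n<1+n n)) ≺y

    module Bounds (φ : PR 1) (φ-elem : Element φ) (φ-nonstd : ¬ Standard dom ord C φ) where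

      φ-L : ∀ {x y} → φ at x ↓ y → L y
      φ-L = proj₁ φ-elem _ _

      φ-above : ∀ {a} → L a → EventuallyAbove φ a
      φ-above = nonstandard⇒eventuallyAbove φ-elem φ-nonstd

      ψ⁺ : PR 1
      ψ⁺ = next^[ proj (# 0) ] φ

      ψ⁺-element : Element ψ⁺
      ψ⁺-element = next^[]-Element φ-elem (⊆*-all λ x → x , ev-proj)

      ψ⁺-nonstandard : ¬ Standard dom ord C ψ⁺
      ψ⁺-nonstandard = eventuallyAbove⇒nonstandard λ a∈L → ⊆*-map
        (λ {x} (y , φ-↓ , a≺y) → let p = y , φ-L φ-↓ in
          _ , next^[]-↓ ev-proj p φ-↓ , ≺-next^ p x a∈L a≺y)
        (φ-above a∈L)

      φ≪ψ⁺ : φ ≪ᶜ ψ⁺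
      φ≪ψ⁺ = ≪ᶜ-from-next^ φ-elem λ i → next^[]-≺ᶜ φ-elem
        (⊆*-map (λ {x} i+1<x → suc i , x , constF-↓ (suc i) , ev-proj , i+1<x) (⊆*-≥ (suc (suc i))))

      bottom : Elt
      bottom = enum 0 , enum-L 0

      t : ℕ → ℕ
      t k = proj₁ (next^ k bottom)

      t-L : ∀ k → L (t k)
      t-L k = proj₂ (next^ k bottom)

      -- k ↦ t (2k + 2)
      stairs : PR 1
      stairs = next^[ comp double (succF ∷ []) ] constF (enum 0)

      stairs-↓ : ∀ k → stairs at k ↓ t (suc k + suc k)
      stairs-↓ k =
        next^[]-↓ (ev-comp (ev-∷ ev-succ ev-[]) (double-↓ (suc k))) bottom (constF-↓ (enum 0))

      depth : PR 1
      depth = firstNotBelow stairs φ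

      depth-↓ : ∀ {x y} → φ at x ↓ y → ∃[ K ] depth at x ↓ K
      depth-↓ φ-↓ =
        let N , y≺tN = next^-unbounded bottom (φ-L φ-↓)
            N<2N+2 = s≤s (m≤m+n N (suc N))
        in firstNotBelow-↓ stairs-↓ φ-↓ {N} (≺-asym (φ-L φ-↓) (t-L (suc N + suc N))
             (≺-trans (φ-L φ-↓) (t-L N) (t-L (suc N + suc N)) y≺tN (next^-strictMono bottom N<2N+2)))

      depth-large : ∀ n → C ⊆* (λ x → ∃[ y ] ∃[ K ] φ at x ↓ y × depth at x ↓ K × n < K)
      depth-large n = ⊆*-map
        (λ (y , φ-↓ , t≺y) → let K , depth-↓K = depth-↓ φ-↓ in
          y , K , φ-↓ , depth-↓K , ≰⇒> λ K≤n → firstNotBelow-stop stairs-↓ φ-↓ depth-↓K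
            (next^-≺-antitone bottom (φ-L φ-↓) (+-mono-≤ (s≤s K≤n) (s≤s K≤n)) t≺y))
        (φ-above (t-L (suc n + suc n)))

      ψ⁻ : PR 1
      ψ⁻ = next^[ depth ] constF (enum 0)

      ψ⁻-↓ : ∀ {x K} → depth at x ↓ K → ψ⁻ at x ↓ t K
      ψ⁻-↓ depth-↓K = next^[]-↓ depth-↓K bottom (constF-↓ (enum 0))

      ψ⁻-element : Element ψ⁻
      ψ⁻-element = next^[]-Element (Element-constF (enum-L 0))
        (⊆*-map (λ (_ , φ-↓) → depth-↓ φ-↓) (proj₂ φ-elem))

      ψ⁻-nonstandard : ¬ Standard dom ord C ψ⁻
      ψ⁻-nonstandard = eventuallyAbove⇒nonstandard λ {a} a∈L →
        let N , a≺tN = next^-unbounded bottom a∈L in ⊆*-map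
          (λ (_ , K , _ , depth-↓K , N<K) →
            t K , ψ⁻-↓ depth-↓K , ≺-trans a∈L (t-L N) (t-L K) a≺tN (next^-strictMono bottom N<K))
          (depth-large N)

      -- With K = depth x = k + 1:  next^(i+1) (t K) = t (i + 1 + K) ≺ t (2K) ≺ φ x  once i + 1 < K.
      ψ⁻≪φ : ψ⁻ ≪ᶜ φ
      ψ⁻≪φ = ≪ᶜ-from-next^ ψ⁻-element λ i → ⊆*-map
        (λ { (y , suc k , φ-↓ , depth-↓K , i+1<K) →
          _ , y , next^[]-↓ (constF-↓ (suc i)) (next^ (suc k) bottom) (ψ⁻-↓ depth-↓K) , φ-↓ ,
          subst (λ q → proj₁ q ≺ y) (sym (next^-+ (suc i) (suc k) bottom))
            (≺-trans (t-L (suc i + suc k)) (t-L (suc k + suc k)) (φ-L φ-↓)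
              (next^-strictMono bottom (+-monoˡ-< (suc k) i+1<K))
              (firstNotBelow-below stairs-↓ φ-↓ depth-↓K (n<1+n k))) })
        (depth-large (suc i))

lemma4p3 : ExcludedMiddle 0ℓ →
    (dom : PR 1) (ord : PR 2) → IsCompLinOrder dom ord → OrderTypeω dom ord →
    (C : ℕ → Set) → Cohesive C →
    (φ : PR 1) → Elem dom ord C φ → ¬ Standard dom ord C φ →
    Σ (PR 1) λ ψ⁻ → Σ (PR 1) λ ψ⁺ →
      (Elem dom ord C ψ⁻ × ¬ Standard dom ord C ψ⁻) ×
      (Elem dom ord C ψ⁺ × ¬ Standard dom ord C ψ⁺) ×
      (ψ⁻ ≪[ dom , ord , C ] φ) × (φ ≪[ dom , ord , C ] ψ⁺)
lemma4p3 _ dom ord isLO ω C cohesive φ φ-elem φ-nonstd =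
  ψ⁻ , ψ⁺ , (ψ⁻-element , ψ⁻-nonstandard) , (ψ⁺-element , ψ⁺-nonstandard) , ψ⁻≪φ , φ≪ψ⁺
  where
  open ComputableOmega dom ord isLO ω
  open CohesivePower C cohesive
  open Bounds φ φ-elem φ-nonstd
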